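{- The inquisitive (global) disjunction $\vee$ is strongly undefinable in propositional dependence logic $\mathbf{PD}$: for every context $\varphi(a,b)$ and any two distinct atoms $p,q$ not occurring in $\varphi(a,b)$, $\varphi(=\!(p),=\!(q))\not\equiv_{M_{pq}} {=\!(p)}\vee{=\!(q)}$ (hence $\varphi(=\!(p),=\!(q))\not\equiv {=\!(p)}\vee{=\!(q)}$), where $M_{pq}$ has worlds $W=\{w_1,w_2,w_3\}$, $p$ true exactly at $w_1,w_2$, $q$ true exactly at $w_2,w_3$, and every other atom false at all worlds.
   Context: Inquisitive semantics: a model is $M=(W,V)$ with $V$ assigning to each world a set of propositional letters; formulas are supported by states $s\subseteq W$. Clauses: $s\models p$ iff $p\in V(w)$ for all $w\in s$; $s\models\neg p$ iff $p\notin V(w)$ for all $w\in s$; $s\models\bot$ iff $s=\emptyset$; $s\models\psi\land\chi$ iff both; $s\models\psi\vee\chi$ (inquisitive disjunction) iff $s\models\psi$ or $s\models\chi$; $s\models\psi\otimes\chi$ iff $s=t_1\cup t_2$ with $t_1\models\psi$, $t_2\models\chi$; $s\models\, =\!(p_1,\dots,p_n;q)$ iff any two worlds of $s$ agreeing on the truth values of $p_1,\dots,p_n$ agree on $q$. The constancy atom $=\!(q)$ is the case $n=0$ (all worlds of $s$ agree on $q$). Propositional dependence logic $\mathbf{PD}$ has formulas $\varphi::= p\mid\neg p\mid\bot\mid =\!(p_1,\dots,p_n;q)\mid\varphi\land\varphi\mid\varphi\otimes\varphi$. A context $\varphi(a,b)$ is a $\mathbf{PD}$ formula in which $a,b$ occur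 neither negated nor inside a dependence atom. $\equiv_M$ means support by the same states of $M$; $\equiv$ means equivalence in all models. -}

module Defs where

open import Data.Nat using (ℕ)
open import Data.Nat.Properties using (_≟_)
open import Data.Bool using (Bool; true; false; if_then_else_)
open import Data.List using (List; [])
open import Data.List.Relation.Unary.All using (All)
open import Data.List.Relation.Unary.Any using (Any)
open import Data.Fin using (Fin; zero; suc)
open import Data.Fin.Subset using (Subset; _∈_; _∪_)
open import Data.Product using (Σ; _×_; _,_)
open import Data.Sum using (_⊎_)
open import Relation.Binary.PropositionalEquality using (_≡_)
open import Relation.Nullary using (¬_; does)
open import Function.Bundles using (_⇔_)

Atom : Set
Atom = ℕ

data Form : Set where
  atom   : Atom → Form
  neg    : Atom → Form
  ⊥f     : Form
  dep    : List Atom → Atom → Form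
  _∧f_   : Form → Form → Form
  _∨f_   : Form → Form → Form
  _⊗_    : Form → Form → Form

con : Atom → Form
con q = dep [] q

record Model : Set where
  field
    size : ℕ
    V    : Fin size → Atom → Bool
open Model public

State : Model → Set
State M = Subset (size M)

AllAgree : (M : Model) → Fin (size M) → Fin (size M) → List Atom → Set
AllAgree M w v ps = All (λ r → V M w r ≡ V M v r) ps

_⊨_ : {M : Model} → State M → Form → Set
_⊨_ {M} s (atom p) = ∀ w → w ∈ s → V M w p ≡ true
_⊨_ {M} s (neg p)  = ∀ w → w ∈ s → V M w p ≡ false
_⊨_ {M} s ⊥f       = ∀ w → ¬ (w ∈ s)
_⊨_ {M} s (dep ps q) =
  ∀ w v → w ∈ s → v ∈ s → AllAgree M w v ps → V M w q ≡ V M v q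
_⊨_ {M} s (φ ∧f ψ) = (_⊨_ {M} s φ) × (_⊨_ {M} s ψ)
_⊨_ {M} s (φ ∨f ψ) = (_⊨_ {M} s φ) ⊎ (_⊨_ {M} s ψ)
_⊨_ {M} s (φ ⊗ ψ)  =
  Σ (State M) λ t₁ → Σ (State M) λ t₂ →
    (s ≡ t₁ ∪ t₂) × (_⊨_ {M} t₁ φ) × (_⊨_ {M} t₂ ψ)

_≡[_]_ : Form → Model → Form → Set
φ ≡[ M ] ψ = (s : State M) → (_⊨_ {M} s φ ⇔ _⊨_ {M} s ψ)

-- Contexts φ(a,b): PD formulas in which the placeholders a, b occur
-- only positively and not inside dependence atoms.
data Ctx : Set where
  atom : Atom → Ctx
  neg  : Atom → Ctx
  ⊥c   : Ctx
  dep  : List Atom → Atom → Ctx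
  _∧c_ : Ctx → Ctx → Ctx
  _⊗c_ : Ctx → Ctx → Ctx
  varA : Ctx
  varB : Ctx

subst : Ctx → Form → Form → Form
subst (atom p) α β = atom p
subst (neg p) α β = neg p
subst ⊥c α β = ⊥f
subst (dep ps q) α β = dep ps q
subst (φ ∧c ψ) α β = subst φ α β ∧f subst ψ α β
subst (φ ⊗c ψ) α β = subst φ α β ⊗ subst ψ α β
subst varA α β = α
subst varB α β = β

data Occurs (r : Atom) : Ctx → Set where
  inAtom : Occurs r (atom r)
  inNeg  : Occurs r (neg r)
  inDepL : ∀ {ps q} → Any (r ≡_) ps → Occurs r (dep ps q)
  inDepR : ∀ {ps} → Occurs r (dep ps r)
  ∧ˡ : ∀ {φ ψ} → Occurs r φ → Occurs r (φ ∧c ψ)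
  ∧ʳ : ∀ {φ ψ} → Occurs r ψ → Occurs r (φ ∧c ψ)
  ⊗ˡ : ∀ {φ ψ} → Occurs r φ → Occurs r (φ ⊗c ψ)
  ⊗ʳ : ∀ {φ ψ} → Occurs r ψ → Occurs r (φ ⊗c ψ)

-- The model M_pq: worlds w₁,w₂,w₃ = 0,1,2; p true exactly at w₁,w₂;
-- q true exactly at w₂,w₃; all other letters false everywhere.
valP : Fin 3 → Bool
valP zero = true
valP (suc zero) = true
valP (suc (suc _)) = false

valQ : Fin 3 → Bool
valQ zero = false
valQ (suc zero) = true
valQ (suc (suc _)) = true

Mpq : Atom → Atom → Model
Mpq p q = record
  { size = 3
  ; V = λ w r → if does (r ≟ p) then valP w
                else (if does (r ≟ q) then valQ w else false)
  }

-- Every formula θ = φ(=(p),=(q)) behaves in M_pq like a flat formula on singletons: since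
-- φ cannot see p or q and every other letter is false everywhere, a nonempty state supporting
-- θ forces every singleton to support θ.  By induction on φ this yields a closure property
-- that =(p) ∨ =(q) lacks: if θ is supported by {w₁,w₂} and by {w₂,w₃}, then also by {w₁,w₃}.
-- In the tensor case either both factors are supported by some nonempty state, and then
-- {w₁,w₃} = {w₁} ∪ {w₃} splits between them, or one factor takes the empty part of both
-- splits and the other factor carries both states.
module Submission where

open import Defs
open import Data.Bool using (true; false)
open import Data.Empty using (⊥-elim)
open import Data.Fin using (Fin; zero; suc)
open import Data.Fin.Subset using (Subset; _∈_; _∪_; ⁅_⁆) renaming (⊥ to ∅)
open import Data.Fin.Subset.Properties
  using (∉⊥; x∈⁅y⁆⇒x≡y; x∈p∪q⁻; ∪-identityˡ; ∪-identityʳ; nonempty?; Empty-unique)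
open import Data.List using ([])
import Data.List.Relation.Unary.All as All
open import Data.Nat.Properties using (_≟_)
open import Data.Product using (_×_; _,_)
open import Data.Sum using (_⊎_; inj₁; inj₂)
open import Data.Vec.Base using (here; there)
open import Function using (_∘_)
open import Function.Bundles using (Equivalence)
open import Relation.Binary.PropositionalEquality using (_≡_; _≢_; refl; sym; trans)
open import Relation.Nullary using (¬_; contradiction; yes; no)
open import Relation.Nullary.Decidable using (dec-true; dec-false)

occurs-distinct : ∀ {p r φ} → ¬ Occurs p φ → Occurs r φ → r ≢ p
occurs-distinct ¬p∈φ r∈φ refl = ¬p∈φ r∈φ

module Support (M : Model) where

  infix 4 _⊩_
  _⊩_ : State M → Form → Set
  s ⊩ φ = _⊨_ {M} s φ

  ∅⊩ : ∀ φ → ∅ ⊩ φ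
  ∅⊩ (atom r)   w w∈∅ = contradiction w∈∅ ∉⊥
  ∅⊩ (neg r)    w w∈∅ = contradiction w∈∅ ∉⊥
  ∅⊩ ⊥f         w     = ∉⊥
  ∅⊩ (dep ps r) w v w∈∅ = contradiction w∈∅ ∉⊥
  ∅⊩ (φ ∧f ψ)   = ∅⊩ φ , ∅⊩ ψ
  ∅⊩ (φ ∨f ψ)   = inj₁ (∅⊩ φ)
  ∅⊩ (φ ⊗ ψ)    = ∅ , ∅ , sym (∪-identityˡ ∅) , ∅⊩ φ , ∅⊩ ψ

  ∈⁅⁆-elim : ∀ {v} {P : Fin (size M) → Set} → P v → ∀ u → u ∈ ⁅ v ⁆ → P u
  ∈⁅⁆-elim {v} Pv u u∈⁅v⁆ rewrite x∈⁅y⁆⇒x≡y v u∈⁅v⁆ = Pv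

  ⁅⁆⊩dep : ∀ w ps r → ⁅ w ⁆ ⊩ dep ps r
  ⁅⁆⊩dep w ps r u v u∈⁅w⁆ v∈⁅w⁆ _
    rewrite x∈⁅y⁆⇒x≡y w u∈⁅w⁆ | x∈⁅y⁆⇒x≡y w v∈⁅w⁆ = refl

  ⊩atom⇒⊩con : ∀ {s r} → s ⊩ atom r → s ⊩ con r
  ⊩atom⇒⊩con s⊩r w v w∈s v∈s _ = trans (s⊩r w w∈s) (sym (s⊩r v v∈s))

  ⊮con : ∀ {s r w v} → w ∈ s → v ∈ s → V M w r ≢ V M v r → ¬ s ⊩ con r
  ⊮con w∈s v∈s w≢v s⊩con = w≢v (s⊩con _ _ w∈s v∈s All.[])

  SingletonSupported : Form → Set
  SingletonSupported φ = ∀ w → ⁅ w ⁆ ⊩ φ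

  con-singletonSupported : ∀ r → SingletonSupported (con r)
  con-singletonSupported r w = ⁅⁆⊩dep w [] r

  -- Singleton support of φ(α,β) at v only depends on the letters of φ, as long as α and β
  -- are supported by all singletons; a state containing w stands in for the singleton {w}.
  ⊩-transfer : (φ : Ctx) {α β : Form} → SingletonSupported α → SingletonSupported β →
               ∀ {s w v} → (∀ {r} → Occurs r φ → V M w r ≡ V M v r) →
               w ∈ s → s ⊩ subst φ α β → ⁅ v ⁆ ⊩ subst φ α β
  ⊩-transfer (atom r) _ _ agree w∈s s⊩r =
    ∈⁅⁆-elim (trans (sym (agree inAtom)) (s⊩r _ w∈s))
  ⊩-transfer (neg r) _ _ agree w∈s s⊩¬r =
    ∈⁅⁆-elim (trans (sym (agree inNeg)) (s⊩¬r _ w∈s))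
  ⊩-transfer ⊥c _ _ _ w∈s s⊩⊥ = ⊥-elim (s⊩⊥ _ w∈s)
  ⊩-transfer (dep ps r) _ _ _ _ _ = ⁅⁆⊩dep _ ps r
  ⊩-transfer (φ ∧c ψ) α⁅⁆ β⁅⁆ agree w∈s (s⊩φ , s⊩ψ) =
    ⊩-transfer φ α⁅⁆ β⁅⁆ (agree ∘ ∧ˡ) w∈s s⊩φ , ⊩-transfer ψ α⁅⁆ β⁅⁆ (agree ∘ ∧ʳ) w∈s s⊩ψ
  ⊩-transfer (φ ⊗c ψ) {α} {β} α⁅⁆ β⁅⁆ {v = v} agree w∈s (t₁ , t₂ , refl , t₁⊩φ , t₂⊩ψ)
    with x∈p∪q⁻ t₁ t₂ w∈s
  ... | inj₁ w∈t₁ = ⁅ v ⁆ , ∅ , sym (∪-identityʳ ⁅ v ⁆) ,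
                    ⊩-transfer φ α⁅⁆ β⁅⁆ (agree ∘ ⊗ˡ) w∈t₁ t₁⊩φ , ∅⊩ (subst ψ α β)
  ... | inj₂ w∈t₂ = ∅ , ⁅ v ⁆ , sym (∪-identityˡ ⁅ v ⁆) ,
                    ∅⊩ (subst φ α β) , ⊩-transfer ψ α⁅⁆ β⁅⁆ (agree ∘ ⊗ʳ) w∈t₂ t₂⊩ψ
  ⊩-transfer varA α⁅⁆ _ _ _ _ = α⁅⁆ _
  ⊩-transfer varB _ β⁅⁆ _ _ _ = β⁅⁆ _

  Flat : Form → Set
  Flat φ = ∀ {s w} → w ∈ s → s ⊩ φ → SingletonSupported φ

  flat-singletonSupported⊎empty : ∀ {φ s t} → Flat φ → s ⊩ φ → t ⊩ φ →
                                  SingletonSupported φ ⊎ (s ≡ ∅ × t ≡ ∅)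
  flat-singletonSupported⊎empty {s = s} {t} flat s⊩φ t⊩φ with nonempty? s | nonempty? t
  ... | yes (w , w∈s) | _             = inj₁ (flat w∈s s⊩φ)
  ... | no _          | yes (w , w∈t) = inj₁ (flat w∈t t⊩φ)
  ... | no s-empty    | no t-empty    = inj₂ (Empty-unique s-empty , Empty-unique t-empty)

module Mpq-properties (p q : Atom) (p≢q : p ≢ q) where

  M : Model
  M = Mpq p q

  open Support M

  w₁ w₂ w₃ : Fin 3
  w₁ = zero
  w₂ = suc zero
  w₃ = suc (suc zero)

  s₁₂ s₂₃ s₁₃ : Subset 3
  s₁₂ = ⁅ w₁ ⁆ ∪ ⁅ w₂ ⁆
  s₂₃ = ⁅ w₂ ⁆ ∪ ⁅ w₃ ⁆
  s₁₃ = ⁅ w₁ ⁆ ∪ ⁅ w₃ ⁆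

  V-p : ∀ w → V M w p ≡ valP w
  V-p w rewrite dec-true (p ≟ p) refl = refl

  V-q : ∀ w → V M w q ≡ valQ w
  V-q w rewrite dec-false (q ≟ p) (p≢q ∘ sym) | dec-true (q ≟ q) refl = refl

  V-other : ∀ {r} → r ≢ p → r ≢ q → ∀ w → V M w r ≡ false
  V-other {r} r≢p r≢q w rewrite dec-false (r ≟ p) r≢p | dec-false (r ≟ q) r≢q = refl

  Θ : Ctx → Form
  Θ φ = subst φ (con p) (con q)

  Θ-flat : ∀ φ → ¬ Occurs p φ → ¬ Occurs q φ → Flat (Θ φ)
  Θ-flat φ ¬p∈φ ¬q∈φ {w = w} w∈s s⊩Θφ v =
    ⊩-transfer φ (con-singletonSupported p) (con-singletonSupported q) agree w∈s s⊩Θφ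
    where
    agree : ∀ {r} → Occurs r φ → V M w r ≡ V M v r
    agree r∈φ = trans (V-other r≢p r≢q w) (sym (V-other r≢p r≢q v))
      where
      r≢p = occurs-distinct ¬p∈φ r∈φ
      r≢q = occurs-distinct ¬q∈φ r∈φ

  p-varies : ∀ {w v} → valP w ≢ valP v → V M w p ≢ V M v p
  p-varies {w} {v} valPw≢valPv Vw≡Vv = valPw≢valPv (trans (sym (V-p w)) (trans Vw≡Vv (V-p v)))

  q-varies : ∀ {w v} → valQ w ≢ valQ v → V M w q ≢ V M v q
  q-varies {w} {v} valQw≢valQv Vw≡Vv = valQw≢valQv (trans (sym (V-q w)) (trans Vw≡Vv (V-q v)))

  Θ-s₁₂-s₂₃⇒s₁₃ : ∀ φ → ¬ Occurs p φ → ¬ Occurs q φ → s₁₂ ⊩ Θ φ → s₂₃ ⊩ Θ φ → s₁₃ ⊩ Θ φ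
  Θ-s₁₂-s₂₃⇒s₁₃ (atom r) ¬p∈φ ¬q∈φ s₁₂⊩r _ = contradiction
    (trans (sym (s₁₂⊩r w₁ here)) (V-other (occurs-distinct ¬p∈φ inAtom) (occurs-distinct ¬q∈φ inAtom) w₁))
    λ ()
  Θ-s₁₂-s₂₃⇒s₁₃ (neg r) ¬p∈φ ¬q∈φ _ _ w _ =
    V-other (occurs-distinct ¬p∈φ inNeg) (occurs-distinct ¬q∈φ inNeg) w
  Θ-s₁₂-s₂₃⇒s₁₃ ⊥c _ _ s₁₂⊩⊥ _ = ⊥-elim (s₁₂⊩⊥ w₁ here)
  Θ-s₁₂-s₂₃⇒s₁₃ (dep ps r) ¬p∈φ ¬q∈φ _ _ w v _ _ _ =
    trans (V-other r≢p r≢q w) (sym (V-other r≢p r≢q v))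
    where
    r≢p = occurs-distinct ¬p∈φ inDepR
    r≢q = occurs-distinct ¬q∈φ inDepR
  Θ-s₁₂-s₂₃⇒s₁₃ (φ ∧c ψ) ¬p∈φ ¬q∈φ (s₁₂⊩φ , s₁₂⊩ψ) (s₂₃⊩φ , s₂₃⊩ψ) =
    Θ-s₁₂-s₂₃⇒s₁₃ φ (¬p∈φ ∘ ∧ˡ) (¬q∈φ ∘ ∧ˡ) s₁₂⊩φ s₂₃⊩φ ,
    Θ-s₁₂-s₂₃⇒s₁₃ ψ (¬p∈φ ∘ ∧ʳ) (¬q∈φ ∘ ∧ʳ) s₁₂⊩ψ s₂₃⊩ψ
  Θ-s₁₂-s₂₃⇒s₁₃ (φ ⊗c ψ) ¬p∈φ ¬q∈φ
    (t₁ , t₂ , s₁₂≡t₁∪t₂ , t₁⊩φ , t₂⊩ψ) (u₁ , u₂ , s₂₃≡u₁∪u₂ , u₁⊩φ , u₂⊩ψ)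
    with flat-singletonSupported⊎empty (Θ-flat φ (¬p∈φ ∘ ⊗ˡ) (¬q∈φ ∘ ⊗ˡ)) t₁⊩φ u₁⊩φ
       | flat-singletonSupported⊎empty (Θ-flat ψ (¬p∈φ ∘ ⊗ʳ) (¬q∈φ ∘ ⊗ʳ)) t₂⊩ψ u₂⊩ψ
  ... | inj₁ φ⁅⁆ | inj₁ ψ⁅⁆ = ⁅ w₁ ⁆ , ⁅ w₃ ⁆ , refl , φ⁅⁆ w₁ , ψ⁅⁆ w₃
  ... | inj₂ (refl , refl) | _
    with refl ← trans s₁₂≡t₁∪t₂ (∪-identityˡ t₂) | refl ← trans s₂₃≡u₁∪u₂ (∪-identityˡ u₂) =
    ∅ , s₁₃ , refl , ∅⊩ (Θ φ) , Θ-s₁₂-s₂₃⇒s₁₃ ψ (¬p∈φ ∘ ⊗ʳ) (¬q∈φ ∘ ⊗ʳ) t₂⊩ψ u₂⊩ψ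
  ... | _ | inj₂ (refl , refl)
    with refl ← trans s₁₂≡t₁∪t₂ (∪-identityʳ t₁) | refl ← trans s₂₃≡u₁∪u₂ (∪-identityʳ u₁) =
    s₁₃ , ∅ , refl , Θ-s₁₂-s₂₃⇒s₁₃ φ (¬p∈φ ∘ ⊗ˡ) (¬q∈φ ∘ ⊗ˡ) t₁⊩φ u₁⊩φ , ∅⊩ (Θ ψ)
  Θ-s₁₂-s₂₃⇒s₁₃ varA _ _ _ s₂₃⊩=p = ⊥-elim (⊮con {r = p} (there here) (there (there here)) (p-varies {w₂} {w₃} λ ()) s₂₃⊩=p)
  Θ-s₁₂-s₂₃⇒s₁₃ varB _ _ s₁₂⊩=q _ = ⊥-elim (⊮con {r = q} here (there here) (q-varies {w₁} {w₂} λ ()) s₁₂⊩=q)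

  s₁₂⊩=p : s₁₂ ⊩ con p
  s₁₂⊩=p = ⊩atom⇒⊩con {r = p} λ w w∈s₁₂ → trans (V-p w) (valP-true w∈s₁₂)
    where
    valP-true : ∀ {w} → w ∈ s₁₂ → valP w ≡ true
    valP-true here = refl
    valP-true (there here) = refl
    valP-true (there (there (there ())))

  s₂₃⊩=q : s₂₃ ⊩ con q
  s₂₃⊩=q = ⊩atom⇒⊩con {r = q} λ w w∈s₂₃ → trans (V-q w) (valQ-true w∈s₂₃)
    where
    valQ-true : ∀ {w} → w ∈ s₂₃ → valQ w ≡ true
    valQ-true (there here) = refl
    valQ-true (there (there here)) = refl

  s₁₃⊮=p∨=q : ¬ s₁₃ ⊩ con p ∨f con q
  s₁₃⊮=p∨=q (inj₁ s₁₃⊩=p) = ⊮con {r = p} here (there (there here)) (p-varies {w₁} {w₃} λ ()) s₁₃⊩=p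
  s₁₃⊮=p∨=q (inj₂ s₁₃⊩=q) = ⊮con {r = q} here (there (there here)) (q-varies {w₁} {w₃} λ ()) s₁₃⊩=q

theorem4p3 : (φ : Ctx) (p q : Atom) → p ≢ q → ¬ Occurs p φ → ¬ Occurs q φ →
    ¬ (subst φ (con p) (con q) ≡[ Mpq p q ] (con p ∨f con q))
theorem4p3 φ p q p≢q ¬p∈φ ¬q∈φ Θφ≡=p∨=q =
  s₁₃⊮=p∨=q (to (Θφ≡=p∨=q s₁₃) (Θ-s₁₂-s₂₃⇒s₁₃ φ ¬p∈φ ¬q∈φ s₁₂⊩Θφ s₂₃⊩Θφ))
  where
  open Mpq-properties p q p≢q
  open Support M
  open Equivalence

  s₁₂⊩Θφ : s₁₂ ⊩ Θ φ
  s₁₂⊩Θφ = from (Θφ≡=p∨=q s₁₂) (inj₁ s₁₂⊩=p)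

  s₂₃⊩Θφ : s₂₃ ⊩ Θ φ
  s₂₃⊩Θφ = from (Θφ≡=p∨=q s₂₃) (inj₂ s₂₃⊩=q)
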